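{- Let $G$ be a finite simple König–Egerváry graph with $n$ vertices. Then the following are equivalent: (i) $\alpha(G)=n/2$; (ii) $G$ has a perfect matching; (iii) $G$ is quasi-regularizable; (iv) $|core(G)|\leq|N(core(G))|$.
   Context: $\alpha(G)$ is the maximum size of a stable set, $\mu(G)$ the maximum size of a matching; $G$ is König–Egerváry if $\alpha(G)+\mu(G)=|V(G)|$. $\Omega(G)$ is the set of maximum stable sets, $core(G)=\bigcap\{S:S\in\Omega(G)\}$, and for $A\subseteq V(G)$, $N(A)$ is the set of vertices adjacent to some vertex of $A$. $G$ is quasi-regularizable if one can replace each edge of $G$ by a non-negative integer number of parallel copies so as to obtain a regular multigraph of nonzero degree. -}

module Defs where

open import Data.Nat using (ℕ; zero; suc; _+_; _*_; _≤_)
open import Data.Bool using (Bool; true; false)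
open import Data.Fin using (Fin)
open import Data.Fin.Subset using (Subset; ∣_∣) renaming (_∈_ to _∈ₛ_)
open import Data.List using (List; []; _∷_; length; concatMap)
open import Data.List.Relation.Unary.All using (All)
open import Data.List.Relation.Unary.Unique.Propositional using (Unique)
open import Data.List.Membership.Propositional using () renaming (_∈_ to _∈ₗ_)
open import Data.Product using (Σ; ∃; _×_; _,_; proj₁; proj₂)
open import Relation.Binary.PropositionalEquality using (_≡_)
open import Relation.Nullary using (¬_)

record Graph (n : ℕ) : Set where
  field
    adj   : Fin n → Fin n → Bool
    sym   : ∀ u v → adj u v ≡ adj v u
    irrefl : ∀ v → adj v v ≡ false
open Graph public

module _ {n : ℕ} (G : Graph n) where

  IsStable : Subset n → Set
  IsStable S = ∀ u v → u ∈ₛ S → v ∈ₛ S → adj G u v ≡ false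

  IsMaxStable : Subset n → Set
  IsMaxStable S = IsStable S × (∀ T → IsStable T → ∣ T ∣ ≤ ∣ S ∣)

  IsAlpha : ℕ → Set
  IsAlpha a = Σ (Subset n) (λ S → IsStable S × ∣ S ∣ ≡ a)
              × (∀ T → IsStable T → ∣ T ∣ ≤ a)

  endpoints : List (Fin n × Fin n) → List (Fin n)
  endpoints = concatMap (λ e → proj₁ e ∷ proj₂ e ∷ [])

  IsMatching : List (Fin n × Fin n) → Set
  IsMatching M = All (λ e → adj G (proj₁ e) (proj₂ e) ≡ true) M × Unique (endpoints M)

  IsMu : ℕ → Set
  IsMu m = Σ (List (Fin n × Fin n)) (λ M → IsMatching M × length M ≡ m)
           × (∀ M → IsMatching M → length M ≤ m)

  IsKE : Set
  IsKE = ∀ a m → IsAlpha a → IsMu m → a + m ≡ n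

  HasPerfectMatching : Set
  HasPerfectMatching = Σ (List (Fin n × Fin n)) (λ M → IsMatching M × (∀ v → v ∈ₗ endpoints M))

  IsCore : Subset n → Set
  IsCore C = ∀ v → (v ∈ₛ C → ∀ S → IsMaxStable S → v ∈ₛ S)
                 × ((∀ S → IsMaxStable S → v ∈ₛ S) → v ∈ₛ C)

  IsNbhd : Subset n → Subset n → Set
  IsNbhd A B = ∀ v → (v ∈ₛ B → ∃ (λ u → u ∈ₛ A × adj G u v ≡ true))
                   × (∃ (λ u → u ∈ₛ A × adj G u v ≡ true) → v ∈ₛ B)

sumFin : ∀ {n} → (Fin n → ℕ) → ℕ
sumFin {zero}  f = 0
sumFin {suc n} f = f Fin.zero + sumFin (λ i → f (Fin.suc i))

module _ {n : ℕ} (G : Graph n) where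
  -- quasi-regularizable: multiplicities w(uv) ∈ ℕ on the edges (symmetric, zero on
  -- non-edges) giving a d-regular multigraph with d ≥ 1
  IsQuasiRegularizable : Set
  IsQuasiRegularizable =
    Σ (Fin n → Fin n → ℕ) λ w →
      (∀ u v → w u v ≡ w v u)
      × (∀ u v → adj G u v ≡ false → w u v ≡ 0)
      × Σ ℕ (λ d → 1 ≤ d × (∀ v → sumFin (λ u → w v u) ≡ d))

{-# OPTIONS --safe #-}

-- König–Egerváry gives α + μ = n, and 2μ ≤ n always, so α = n/2 exactly when α ≤ μ, and then a
-- maximum matching M is perfect.  A perfect matching is a 1-regular spanning multigraph, and its
-- mate map sends every vertex set A injectively into N(A).  Conversely, double counting the weights
-- of a d-regular multigraph shows |S| ≤ |V ∖ S| for every stable S, so α ≤ μ.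
--
-- For (iv) ⇒ (i): a maximum stable set T satisfies |T| + |M| = n while every edge of M leaves T,
-- so M covers V ∖ T and every edge of M has exactly one end in T.  If α > μ, a vertex x of a
-- maximum stable set is missed by M; then x lies in every maximum stable set, and every vertex of
-- N(core) is matched to a vertex of the core.  So the mate map sends N(core) injectively into
-- core ∖ {x}, contradicting |core| ≤ |N(core)|.

module Submission where

open import Defs hiding (sym)
open import Data.Nat using (ℕ; zero; suc; _+_; _*_; _∸_; _≤_; _<_; z≤n; s≤s; >-nonZero)
open import Data.Nat.Properties
open import Data.Bool using (true; false; if_then_else_)
import Data.Bool.Properties as Bool
open import Data.Maybe using (Maybe; just; nothing; fromMaybe)
open import Data.Fin using (Fin; zero; suc)
import Data.Fin.Properties as Fin
open import Data.Fin.Subset using (Subset; ∣_∣; inside; outside; ∁; ⁅_⁆)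
  renaming (_∈_ to _∈ₛ_; _∉_ to _∉ₛ_; ⊥ to ∅)
open import Data.Fin.Subset.Properties
  using ( ∣∁p∣≡n∸∣p∣; ∣⊥∣≡0; ∣p∣≤n; ∉⊥; anySubset?; ∣⁅x⁆∣≡1; x∈⁅y⁆⇒x≡y; x∈⁅y⁆⇔x≡y
        ; x∉p⇒x∈∁p; x∉∁p⇒x∈p)
  renaming (_∈?_ to _∈ₛ?_)
open import Data.Vec using ([]; _∷_; here; there; lookup; tabulate)
open import Data.Vec.Properties using (lookup∘tabulate; lookup⇒[]=; []=⇒lookup)
open import Data.List using (List; []; _∷_; _++_; length; map; filter; allFin)
open import Data.List.Properties
  using (length-map; length-filter; length-++; length-++-sucʳ; length-tabulate; filter-++)
open import Data.List.Relation.Unary.All as All using (All; []; _∷_)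
open import Data.List.Relation.Unary.All.Properties as All using ()
open import Data.List.Relation.Unary.Any as Any using (here; there)
open import Data.List.Relation.Unary.Unique.Propositional using (Unique; []; _∷_)
import Data.List.Relation.Unary.Unique.Propositional.Properties as Unique
open import Data.List.Membership.Propositional using () renaming (_∈_ to _∈ₗ_; _∉_ to _∉ₗ_)
open import Data.List.Membership.Propositional.Properties
  using (∈-∃++; ∈-++⁻; ∈-++⁺ˡ; ∈-++⁺ʳ; ∈-map⁺; ∈-map⁻; ∈-allFin; ∈-filter⁺; ∈-filter⁻)
open import Data.List.Relation.Binary.Subset.Propositional using (_⊆_)
open import Data.Product as Product using (∃; _×_; _,_; proj₁; proj₂)
open import Data.Sum as Sum using (_⊎_; inj₁; inj₂)
open import Function using (_∘_; flip; _⇔_; mk⇔; Injective; Equivalence)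
open import Relation.Binary.PropositionalEquality
open import Relation.Nullary using (¬_; Dec; yes; no; does; ¬?; contradiction)
open import Relation.Nullary.Decidable as Dec using (decidable-stable; dec-true; dec-false; _×-dec_; _→-dec_)
open import Relation.Unary using (Pred; Decidable)
open import Level using (0ℓ)
open import Algebra.Properties.CommutativeMonoid.Sum +-0-commutativeMonoid
  using (sum; sum-syntax; sum-cong-≗; ∑-comm)
open import Algebra.Properties.Semiring.Sum +-*-semiring using (*-distribˡ-sum; *-distribʳ-sum)

-- Counting duplicate-free lists

module _ {A : Set} where

  Unique-⊆⇒length≤ : ∀ {xs ys : List A} → Unique xs → xs ⊆ ys → length xs ≤ length ys
  Unique-⊆⇒length≤ {[]}     _              _     = z≤n
  Unique-⊆⇒length≤ {x ∷ xs} (x∉xs ∷ xs!) xs⊆ys with us , vs , refl ← ∈-∃++ (xs⊆ys (here refl)) = begin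
      suc (length xs)         ≤⟨ s≤s (Unique-⊆⇒length≤ xs! xs⊆us++vs) ⟩
      suc (length (us ++ vs)) ≡⟨ length-++-sucʳ us x vs ⟨
      length (us ++ x ∷ vs)   ∎
    where
    open ≤-Reasoning
    xs⊆us++vs : xs ⊆ us ++ vs
    xs⊆us++vs y∈xs with ∈-++⁻ us (xs⊆ys (there y∈xs))
    ... | inj₁ y∈us         = ∈-++⁺ˡ y∈us
    ... | inj₂ (here refl)  = contradiction refl (All.lookup x∉xs y∈xs)
    ... | inj₂ (there y∈vs) = ∈-++⁺ʳ us y∈vs

  Unique-∷⁺ : ∀ {x} {xs : List A} → x ∉ₗ xs → Unique xs → Unique (x ∷ xs)
  Unique-∷⁺ {x} {xs} x∉xs xs! =
    All.tabulate (λ y∈xs x≡y → x∉xs (subst (_∈ₗ xs) (sym x≡y) y∈xs)) ∷ xs!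

_∈ₗ?_ : ∀ {n} (v : Fin n) xs → Dec (v ∈ₗ xs)
v ∈ₗ? xs = Any.any? (v Fin.≟_) xs

module _ {n : ℕ} where

  length-allFin : length (allFin n) ≡ n
  length-allFin = length-tabulate (λ i → i)

  Unique⇒length≤n : ∀ {xs : List (Fin n)} → Unique xs → length xs ≤ n
  Unique⇒length≤n xs! = ≤-trans (Unique-⊆⇒length≤ xs! (λ {x} _ → ∈-allFin x)) (≤-reflexive length-allFin)

  complete⇒n≤length : ∀ {xs : List (Fin n)} → (∀ v → v ∈ₗ xs) → n ≤ length xs
  complete⇒n≤length all∈ =
    ≤-trans (≤-reflexive (sym length-allFin)) (Unique-⊆⇒length≤ (Unique.allFin⁺ n) (λ {x} _ → all∈ x))

  Unique∧length≡n⇒complete : ∀ {xs : List (Fin n)} → Unique xs → length xs ≡ n → ∀ v → v ∈ₗ xs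
  Unique∧length≡n⇒complete {xs} xs! len v = decidable-stable (v ∈ₗ? xs) λ v∉xs →
    <⇒≱ (≤-reflexive (cong suc (sym len))) (Unique⇒length≤n (Unique-∷⁺ v∉xs xs!))

toList : ∀ {n} → Subset n → List (Fin n)
toList []            = []
toList (inside  ∷ p) = zero ∷ map suc (toList p)
toList (outside ∷ p) = map suc (toList p)

∈-toList⁺ : ∀ {n} {p : Subset n} {x} → x ∈ₛ p → x ∈ₗ toList p
∈-toList⁺ {p = inside  ∷ p} here        = here refl
∈-toList⁺ {p = inside  ∷ p} (there x∈p) = there (∈-map⁺ suc (∈-toList⁺ x∈p))
∈-toList⁺ {p = outside ∷ p} (there x∈p) = ∈-map⁺ suc (∈-toList⁺ x∈p)

∈-toList⁻ : ∀ {n} {p : Subset n} {x} → x ∈ₗ toList p → x ∈ₛ p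
∈-toList⁻ {p = inside  ∷ p} (here refl) = here
∈-toList⁻ {p = inside  ∷ p} (there x∈)
  with _ , y∈ , refl ← ∈-map⁻ suc x∈ = there (∈-toList⁻ y∈)
∈-toList⁻ {p = outside ∷ p} x∈
  with _ , y∈ , refl ← ∈-map⁻ suc x∈ = there (∈-toList⁻ y∈)

length-toList : ∀ {n} (p : Subset n) → length (toList p) ≡ ∣ p ∣
length-toList []            = refl
length-toList (inside  ∷ p) = cong suc (trans (length-map suc (toList p)) (length-toList p))
length-toList (outside ∷ p) = trans (length-map suc (toList p)) (length-toList p)

toList-Unique : ∀ {n} (p : Subset n) → Unique (toList p)
toList-Unique []            = []
toList-Unique (inside  ∷ p) =
  All.map⁺ (All.universal (λ _ ()) (toList p)) ∷ Unique.map⁺ Fin.suc-injective (toList-Unique p)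
toList-Unique (outside ∷ p) = Unique.map⁺ Fin.suc-injective (toList-Unique p)

∣p∣+m≡n⇒∣∁p∣≡m : ∀ {n} {p : Subset n} {m} → ∣ p ∣ + m ≡ n → ∣ ∁ p ∣ ≡ m
∣p∣+m≡n⇒∣∁p∣≡m {p = p} {m} p+m≡n =
  trans (∣∁p∣≡n∸∣p∣ p) (trans (cong (_∸ ∣ p ∣) (sym p+m≡n)) (m+n∸m≡n ∣ p ∣ m))

Unique⇒length≤∣p∣ : ∀ {n} {p : Subset n} {xs} →
                    Unique xs → (∀ {x} → x ∈ₗ xs → x ∈ₛ p) → length xs ≤ ∣ p ∣
Unique⇒length≤∣p∣ {p = p} xs! xs⊆p =
  ≤-trans (Unique-⊆⇒length≤ xs! (∈-toList⁺ ∘ xs⊆p)) (≤-reflexive (length-toList p))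

module _ {n} {p q : Subset n} {f : Fin n → Fin n}
         (f-injective : Injective _≡_ _≡_ f) (f[p]⊆q : ∀ {x} → x ∈ₛ p → f x ∈ₛ q) where

  private
    image : List (Fin n)
    image = map f (toList p)

    image! : Unique image
    image! = Unique.map⁺ f-injective (toList-Unique p)

    image⊆q : ∀ {y} → y ∈ₗ image → y ∈ₛ q
    image⊆q y∈ with x , x∈ , refl ← ∈-map⁻ f y∈ = f[p]⊆q (∈-toList⁻ x∈)

    length-image : length image ≡ ∣ p ∣
    length-image = trans (length-map f (toList p)) (length-toList p)

  injective⇒∣p∣≤∣q∣ : ∣ p ∣ ≤ ∣ q ∣
  injective⇒∣p∣≤∣q∣ = subst (_≤ ∣ q ∣) length-image (Unique⇒length≤∣p∣ image! image⊆q)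

  injective-missing⇒∣p∣<∣q∣ : ∀ {y} → y ∈ₛ q → (∀ {x} → x ∈ₛ p → f x ≢ y) → ∣ p ∣ < ∣ q ∣
  injective-missing⇒∣p∣<∣q∣ {y} y∈q y∉f[p] =
    subst (λ k → suc k ≤ ∣ q ∣) length-image
          (Unique⇒length≤∣p∣ (Unique-∷⁺ y∉image image!) y∷image⊆q)
    where
    y∉image : y ∉ₗ image
    y∉image y∈ with x , x∈ , y≡fx ← ∈-map⁻ f y∈ = y∉f[p] (∈-toList⁻ x∈) (sym y≡fx)
    y∷image⊆q : ∀ {z} → z ∈ₗ y ∷ image → z ∈ₛ q
    y∷image⊆q (here refl) = y∈q
    y∷image⊆q (there z∈)  = image⊆q z∈

module _ {n} {P : Pred (Fin n) 0ℓ} (P? : Decidable P) where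

  fromDec : Subset n
  fromDec = tabulate (does ∘ P?)

  ∈-fromDec : ∀ {x} → x ∈ₛ fromDec ⇔ P x
  ∈-fromDec {x} = mk⇔ to from
    where
    lookup-fromDec : lookup fromDec x ≡ does (P? x)
    lookup-fromDec = lookup∘tabulate (does ∘ P?) x
    to : x ∈ₛ fromDec → P x
    to x∈ = decidable-stable (P? x) λ ¬px →
      contradiction (trans (sym ([]=⇒lookup x∈)) (trans lookup-fromDec (dec-false (P? x) ¬px))) λ ()
    from : P x → x ∈ₛ fromDec
    from px = lookup⇒[]= x fromDec (trans lookup-fromDec (dec-true (P? x) px))

-- Finite sums

sumFin≡sum : ∀ {n} (f : Fin n → ℕ) → sumFin f ≡ sum f
sumFin≡sum {zero}  f = refl
sumFin≡sum {suc n} f = cong (f zero +_) (sumFin≡sum (f ∘ suc))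

sum-mono-≤ : ∀ {n} {f g : Fin n → ℕ} → (∀ i → f i ≤ g i) → sum f ≤ sum g
sum-mono-≤ {zero}  _   = z≤n
sum-mono-≤ {suc n} f≤g = +-mono-≤ (f≤g zero) (sum-mono-≤ (f≤g ∘ suc))

χ : ∀ {n} → Subset n → Fin n → ℕ
χ p x = if does (x ∈ₛ? p) then 1 else 0

∑χ≡∣p∣ : ∀ {n} (p : Subset n) → ∑[ x < n ] χ p x ≡ ∣ p ∣
∑χ≡∣p∣ []            = refl
∑χ≡∣p∣ (inside  ∷ p) = cong suc (∑χ≡∣p∣ p)
∑χ≡∣p∣ (outside ∷ p) = ∑χ≡∣p∣ p

∑χ*c≡∣p∣*c : ∀ {n} (p : Subset n) c → ∑[ x < n ] (χ p x * c) ≡ ∣ p ∣ * c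
∑χ*c≡∣p∣*c p c = trans (sym (*-distribʳ-sum c (χ p))) (cong (_* c) (∑χ≡∣p∣ p))

module _ {n} (w : Fin n → Fin n → ℕ) (w-sym : ∀ u v → w u v ≡ w v u)
         {d} (w-regular : ∀ v → sum (w v) ≡ d) where

  regular⇒∣S∣*d≤∣∁S∣*d : ∀ (S : Subset n) → (∀ {u v} → u ∈ₛ S → v ∈ₛ S → w u v ≡ 0) →
                         ∣ S ∣ * d ≤ ∣ ∁ S ∣ * d
  regular⇒∣S∣*d≤∣∁S∣*d S w[S]≡0 = begin
    ∣ S ∣ * d                                   ≡⟨ ∑χ*c≡∣p∣*c S d ⟨
    ∑[ v < n ] (χ S v * d)                      ≡⟨ sum-cong-≗ (λ v → cong (χ S v *_) (w-regular v)) ⟨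
    ∑[ v < n ] (χ S v * ∑[ u < n ] w v u)       ≡⟨ sum-cong-≗ (λ v → *-distribˡ-sum (χ S v) (w v)) ⟩
    ∑[ v < n ] ∑[ u < n ] (χ S v * w v u)       ≤⟨ sum-mono-≤ (λ v → sum-mono-≤ (λ u → χ*w≤χ∁*w v u)) ⟩
    ∑[ v < n ] ∑[ u < n ] (χ (∁ S) u * w v u)   ≡⟨ ∑-comm (λ v u → χ (∁ S) u * w v u) ⟩
    ∑[ u < n ] ∑[ v < n ] (χ (∁ S) u * w v u)   ≡⟨ sum-cong-≗ (λ u → *-distribˡ-sum (χ (∁ S) u) (flip w u)) ⟨
    ∑[ u < n ] (χ (∁ S) u * ∑[ v < n ] w v u)   ≡⟨ sum-cong-≗ (λ u → cong (χ (∁ S) u *_) (in-degree u)) ⟩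
    ∑[ u < n ] (χ (∁ S) u * d)                  ≡⟨ ∑χ*c≡∣p∣*c (∁ S) d ⟩
    ∣ ∁ S ∣ * d                                 ∎
    where
    open ≤-Reasoning
    in-degree : ∀ u → ∑[ v < n ] w v u ≡ d
    in-degree u = trans (sum-cong-≗ (λ v → w-sym v u)) (w-regular u)
    χ*w≤χ∁*w : ∀ v u → χ S v * w v u ≤ χ (∁ S) u * w v u
    χ*w≤χ∁*w v u with v ∈ₛ? S | u ∈ₛ? ∁ S
    ... | no _    | _       = z≤n
    ... | yes _   | yes _   = ≤-refl
    ... | yes v∈S | no u∉∁S = ≤-reflexive (trans (+-identityʳ (w v u)) (w[S]≡0 v∈S (x∉∁p⇒x∈p u∉∁S)))

-- Finite search

∃-greatest : ∀ {P : Pred ℕ 0ℓ} → Decidable P → P 0 → ∀ b → (∀ k → P k → k ≤ b) →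
             ∃ λ a → P a × (∀ k → P k → k ≤ a)
∃-greatest P? p0 b P≤b with P? b
... | yes pb = b , pb , P≤b
∃-greatest P? p0 zero    P≤b | no ¬p0 = contradiction p0 ¬p0
∃-greatest {P} P? p0 (suc b) P≤1+b | no ¬pb = ∃-greatest P? p0 b P≤b
  where
  P≤b : ∀ k → P k → k ≤ b
  P≤b k pk = m<1+n⇒m≤n (≤∧≢⇒< (P≤1+b k pk) λ { refl → ¬pb pk })

Searchable : Set → Set₁
Searchable A = ∀ {P : Pred A 0ℓ} → Decidable P → Dec (∃ P)

Fin²-searchable : ∀ {n} → Searchable (Fin n × Fin n)
Fin²-searchable P? = Dec.map′ (λ (u , v , p) → (u , v) , p) (λ ((u , v) , p) → u , v , p)
                               (Fin.any? λ u → Fin.any? λ v → P? (u , v))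

lists-of-length? : ∀ {A} → Searchable A → ∀ k {Q : Pred (List A) 0ℓ} → Decidable Q →
                   Dec (∃ λ xs → Q xs × length xs ≡ k)
lists-of-length? search zero    Q? = Dec.map′ (λ q → [] , q , refl) (λ { ([] , q , _) → q }) (Q? [])
lists-of-length? search (suc k) Q? =
  Dec.map′ (λ (x , xs , q , len) → x ∷ xs , q , cong suc len)
           (λ { (x ∷ xs , q , len) → x , xs , q , suc-injective len })
           (search λ x → lists-of-length? search k λ xs → Q? (x ∷ xs))

-- Stable sets and matchings

module _ {n : ℕ} (G : Graph n) where

  open import Data.List.Relation.Unary.Unique.DecPropositional (Fin._≟_ {n}) using (unique?)

  adj-sym : ∀ {u v} → adj G u v ≡ true → adj G v u ≡ true
  adj-sym {u} {v} = trans (Graph.sym G v u)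

  stable-edge : ∀ {S u v} → IsStable G S → adj G u v ≡ true → u ∉ₛ S ⊎ v ∉ₛ S
  stable-edge {S} {u} {v} S-stable uv with u ∈ₛ? S | v ∈ₛ? S
  ... | yes u∈S | yes v∈S = contradiction (trans (sym uv) (S-stable u v u∈S v∈S)) λ ()
  ... | no u∉S  | _       = inj₁ u∉S
  ... | yes _   | no v∉S  = inj₂ v∉S

  stable? : Decidable (IsStable G)
  stable? S = Fin.all? λ u → Fin.all? λ v → u ∈ₛ? S →-dec (v ∈ₛ? S →-dec (adj G u v Bool.≟ false))

  matching? : Decidable (IsMatching G)
  matching? M = All.all? (λ e → adj G (proj₁ e) (proj₂ e) Bool.≟ true) M ×-dec unique? (endpoints G M)

  length-endpoints : ∀ M → length (endpoints G M) ≡ 2 * length M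
  length-endpoints []      = refl
  length-endpoints (_ ∷ M) =
    cong suc (trans (cong suc (length-endpoints M)) (sym (+-suc (length M) (length M + 0))))

  matching-size : ∀ {M} → IsMatching G M → 2 * length M ≤ n
  matching-size {M} (_ , M!) = subst (_≤ n) (length-endpoints M) (Unique⇒length≤n M!)

  matching-length≤n : ∀ {M} → IsMatching G M → length M ≤ n
  matching-length≤n {M} M-matching = ≤-trans (m≤n*m (length M) 2) (matching-size M-matching)

  ∈-endpoints : ∀ {M u v} → (u , v) ∈ₗ M → u ∈ₗ endpoints G M × v ∈ₗ endpoints G M
  ∈-endpoints (here refl) = here refl , there (here refl)
  ∈-endpoints (there e∈M) =
    Product.map (λ u∈ → there (there u∈)) (λ v∈ → there (there v∈)) (∈-endpoints e∈M)

  partner : List (Fin n × Fin n) → Fin n → Maybe (Fin n)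
  partner []            w = nothing
  partner ((u , v) ∷ M) w =
    if does (w Fin.≟ u) then just v else if does (w Fin.≟ v) then just u else partner M w

  mate : List (Fin n × Fin n) → Fin n → Fin n
  mate M w = fromMaybe w (partner M w)

  partner-sound : ∀ M {v p} → partner M v ≡ just p → (v , p) ∈ₗ M ⊎ (p , v) ∈ₗ M
  partner-sound ((a , b) ∷ M) {v} eq with v Fin.≟ a | v Fin.≟ b
  partner-sound ((a , b) ∷ M) refl | yes refl | _        = inj₁ (here refl)
  partner-sound ((a , b) ∷ M) refl | no _     | yes refl = inj₂ (here refl)
  partner-sound ((a , b) ∷ M) eq   | no _     | no _     = Sum.map there there (partner-sound M eq)

  partner-∈ : ∀ M {v p} → partner M v ≡ just p → v ∈ₗ endpoints G M × p ∈ₗ endpoints G M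
  partner-∈ M eq with partner-sound M eq
  ... | inj₁ vp∈M = ∈-endpoints vp∈M
  ... | inj₂ pv∈M = Product.swap (∈-endpoints pv∈M)

  partner-mate : ∀ M {v} → v ∈ₗ endpoints G M → partner M v ≡ just (mate M v)
  partner-mate ((a , b) ∷ M) {v} v∈ with v Fin.≟ a | v Fin.≟ b
  ... | yes _   | _      = refl
  ... | no _    | yes _  = refl
  ... | no v≢a  | no v≢b with v∈
  ...   | here v≡a          = contradiction v≡a v≢a
  ...   | there (here v≡b)  = contradiction v≡b v≢b
  ...   | there (there v∈M) = partner-mate M v∈M

  partner-skip : ∀ {a b} M {v} → v ≢ a → v ≢ b → partner ((a , b) ∷ M) v ≡ partner M v
  partner-skip {a} {b} M {v} v≢a v≢b with v Fin.≟ a | v Fin.≟ b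
  ... | yes v≡a | _       = contradiction v≡a v≢a
  ... | no _    | yes v≡b = contradiction v≡b v≢b
  ... | no _    | no _    = refl

  partner-involutive : ∀ M → Unique (endpoints G M) →
                       ∀ {v p} → partner M v ≡ just p → partner M p ≡ just v
  partner-involutive ((a , b) ∷ M) (a∉ ∷ b∉ ∷ M!) {v} eq with v Fin.≟ a | v Fin.≟ b
  partner-involutive ((a , b) ∷ M) (a∉ ∷ b∉ ∷ M!) refl | yes refl | _ with b Fin.≟ a | b Fin.≟ b
  ... | yes b≡a | _      = contradiction (sym b≡a) (All.head a∉)
  ... | no _    | yes _  = refl
  ... | no _    | no b≢b = contradiction refl b≢b
  partner-involutive ((a , b) ∷ M) _ refl | no _ | yes refl with a Fin.≟ a
  ... | yes _  = refl
  ... | no a≢a = contradiction refl a≢a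
  partner-involutive ((a , b) ∷ M) (a∉ ∷ b∉ ∷ M!) {p = p} eq | no _ | no _ =
    trans (partner-skip M p≢a p≢b) (partner-involutive M M! eq)
    where
    p∈M : p ∈ₗ endpoints G M
    p∈M = proj₂ (partner-∈ M eq)
    p≢a : p ≢ a
    p≢a p≡a = All.lookup (All.tail a∉) p∈M (sym p≡a)
    p≢b : p ≢ b
    p≢b p≡b = All.lookup b∉ p∈M (sym p≡b)

  module _ {M} (M-matching : IsMatching G M) where

    mate-involutive : ∀ v → mate M (mate M v) ≡ v
    mate-involutive v with partner M v in eq
    ... | nothing = cong (fromMaybe v) eq
    ... | just p  = cong (fromMaybe p) (partner-involutive M (proj₂ M-matching) eq)

    mate-injective : Injective _≡_ _≡_ (mate M)
    mate-injective {u} {v} eq = begin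
      u                   ≡⟨ mate-involutive u ⟨
      mate M (mate M u)   ≡⟨ cong (mate M) eq ⟩
      mate M (mate M v)   ≡⟨ mate-involutive v ⟩
      v                   ∎
      where open ≡-Reasoning

    mate-edge : ∀ {v} → v ∈ₗ endpoints G M → (v , mate M v) ∈ₗ M ⊎ (mate M v , v) ∈ₗ M
    mate-edge v∈ = partner-sound M (partner-mate M v∈)

    mate-∈ : ∀ {v} → v ∈ₗ endpoints G M → mate M v ∈ₗ endpoints G M
    mate-∈ v∈ = proj₂ (partner-∈ M (partner-mate M v∈))

    mate-adj : ∀ {v} → v ∈ₗ endpoints G M → adj G v (mate M v) ≡ true
    mate-adj v∈ with mate-edge v∈
    ... | inj₁ e∈M = All.lookup (proj₁ M-matching) e∈M
    ... | inj₂ e∈M = adj-sym (All.lookup (proj₁ M-matching) e∈M)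

  module _ {P : Pred (Fin n) 0ℓ} (P? : Decidable P) where

    private
      #P : List (Fin n) → ℕ
      #P xs = length (filter P? xs)

      #P-endpoints-∷ : ∀ u v M → #P (endpoints G ((u , v) ∷ M)) ≡ #P (u ∷ v ∷ []) + #P (endpoints G M)
      #P-endpoints-∷ u v M =
        trans (cong length (filter-++ P? (u ∷ v ∷ []) (endpoints G M))) (length-++ (filter P? (u ∷ v ∷ [])))

      1≤#P-pair : ∀ {u v} → P u ⊎ P v → 1 ≤ #P (u ∷ v ∷ [])
      1≤#P-pair {u} {v} Pu⊎Pv with P? u
      ... | yes _ = s≤s z≤n
      ... | no ¬Pu with P? v | Pu⊎Pv
      ...   | yes _  | _       = s≤s z≤n
      ...   | no _   | inj₁ Pu = contradiction Pu ¬Pu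
      ...   | no ¬Pv | inj₂ Pv = contradiction Pv ¬Pv

      2≤#P-pair : ∀ {u v} → P u → P v → 2 ≤ #P (u ∷ v ∷ [])
      2≤#P-pair {u} {v} Pu Pv with P? u
      ... | no ¬Pu = contradiction Pu ¬Pu
      ... | yes _ with P? v
      ...   | yes _  = s≤s (s≤s z≤n)
      ...   | no ¬Pv = contradiction Pv ¬Pv

      #P-pair≤1 : ∀ {u v} → ¬ P u ⊎ ¬ P v → #P (u ∷ v ∷ []) ≤ 1
      #P-pair≤1 {u} {v} ¬Pu⊎¬Pv with P? u
      ... | no _ = length-filter P? (v ∷ [])
      ... | yes Pu with P? v | ¬Pu⊎¬Pv
      ...   | no _   | _        = ≤-refl
      ...   | yes _  | inj₁ ¬Pu = contradiction Pu ¬Pu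
      ...   | yes Pv | inj₂ ¬Pv = contradiction Pv ¬Pv

    length≤#P-endpoints : ∀ {M} → All (λ e → P (proj₁ e) ⊎ P (proj₂ e)) M → length M ≤ #P (endpoints G M)
    length≤#P-endpoints []                        = z≤n
    length≤#P-endpoints {(u , v) ∷ M} (uv ∷ rest) = subst (suc (length M) ≤_) (sym (#P-endpoints-∷ u v M))
      (+-mono-≤ (1≤#P-pair uv) (length≤#P-endpoints rest))

    length<#P-endpoints : ∀ {M u v} → All (λ e → P (proj₁ e) ⊎ P (proj₂ e)) M → (u , v) ∈ₗ M → P u → P v →
                          length M < #P (endpoints G M)
    length<#P-endpoints {(u , v) ∷ M} (_ ∷ rest) (here refl) Pu Pv = subst (2 + length M ≤_) (sym (#P-endpoints-∷ u v M))
      (+-mono-≤ (2≤#P-pair Pu Pv) (length≤#P-endpoints rest))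
    length<#P-endpoints {(a , b) ∷ M} (ab ∷ rest) (there e∈M) Pu Pv = subst (2 + length M ≤_) (sym (#P-endpoints-∷ a b M))
      (+-mono-≤ (1≤#P-pair ab) (length<#P-endpoints rest e∈M Pu Pv))

    #P-endpoints≤length : ∀ {M} → All (λ e → ¬ P (proj₁ e) ⊎ ¬ P (proj₂ e)) M →
                          #P (endpoints G M) ≤ length M
    #P-endpoints≤length []                        = z≤n
    #P-endpoints≤length {(u , v) ∷ M} (uv ∷ rest) = subst (_≤ suc (length M)) (sym (#P-endpoints-∷ u v M))
      (+-mono-≤ (#P-pair≤1 uv) (#P-endpoints≤length rest))

  -- The endpoints of M outside T are at most |∁ T| = |M| many, and every edge of M supplies one;
  -- a vertex of ∁ T left uncovered, or an edge with both ends in ∁ T, would supply one too many.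
  module Tight {T : Subset n} (T-stable : IsStable G T) {M} (M-matching : IsMatching G M)
               (T+M≡n : ∣ T ∣ + length M ≡ n) where

    private
      _∉T? : Decidable (_∉ₛ T)
      v ∉T? = ¬? (v ∈ₛ? T)

      outsiders : List (Fin n)
      outsiders = filter _∉T? (endpoints G M)

      outsiders! : Unique outsiders
      outsiders! = Unique.filter⁺ _∉T? (proj₂ M-matching)

      outsiders∉T : ∀ {x} → x ∈ₗ outsiders → x ∉ₛ T
      outsiders∉T x∈ = proj₂ (∈-filter⁻ _∉T? {xs = endpoints G M} x∈)

      edges-leave-T : All (λ e → proj₁ e ∉ₛ T ⊎ proj₂ e ∉ₛ T) M
      edges-leave-T = All.map (stable-edge T-stable) (proj₁ M-matching)

      length≤∣M∣ : ∀ {xs} → Unique xs → (∀ {x} → x ∈ₗ xs → x ∉ₛ T) → length xs ≤ length M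
      length≤∣M∣ xs! xs∉T = ≤-trans (Unique⇒length≤∣p∣ xs! (λ x∈ → x∉p⇒x∈∁p (xs∉T x∈)))
                                    (≤-reflexive (∣p∣+m≡n⇒∣∁p∣≡m {p = T} T+M≡n))

    outside-matched : ∀ {v} → v ∉ₛ T → v ∈ₗ endpoints G M
    outside-matched {v} v∉T = decidable-stable (v ∈ₗ? endpoints G M) λ v∉M →
      <⇒≱ (s≤s (length≤#P-endpoints _∉T? edges-leave-T))
          (length≤∣M∣ (Unique-∷⁺ (v∉M ∘ proj₁ ∘ ∈-filter⁻ _∉T?) outsiders!) v∷outsiders∉T)
      where
      v∷outsiders∉T : ∀ {x} → x ∈ₗ v ∷ outsiders → x ∉ₛ T
      v∷outsiders∉T (here refl) = v∉T
      v∷outsiders∉T (there x∈)  = outsiders∉T x∈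

    mate-outside∈T : ∀ {v} → v ∈ₗ endpoints G M → v ∉ₛ T → mate M v ∈ₛ T
    mate-outside∈T {v} v∈M v∉T = decidable-stable (mate M v ∈ₛ? T) λ w∉T →
      <⇒≱ (edge-outside (mate-edge M-matching v∈M) w∉T) (length≤∣M∣ outsiders! outsiders∉T)
      where
      edge-outside : (v , mate M v) ∈ₗ M ⊎ (mate M v , v) ∈ₗ M → mate M v ∉ₛ T →
                     length M < length outsiders
      edge-outside (inj₁ e∈M) w∉T = length<#P-endpoints _∉T? edges-leave-T e∈M v∉T w∉T
      edge-outside (inj₂ e∈M) w∉T = length<#P-endpoints _∉T? edges-leave-T e∈M w∉T v∉T

  stable-unmatched : ∀ {S M} → IsStable G S → IsMatching G M → length M < ∣ S ∣ →
                     ∃ λ x → x ∈ₛ S × x ∉ₗ endpoints G M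
  stable-unmatched {S} {M} S-stable M-matching M<S =
    decidable-stable (Fin.any? λ x → x ∈ₛ? S ×-dec ¬? (x ∈ₗ? endpoints G M)) λ ∄x → <⇒≱ M<S (begin
      ∣ S ∣                                      ≡⟨ length-toList S ⟨
      length (toList S)                          ≤⟨ Unique-⊆⇒length≤ (toList-Unique S) (S⊆matched ∄x ∘ ∈-toList⁻) ⟩
      length (filter (_∈ₛ? S) (endpoints G M))   ≤⟨ #P-endpoints≤length (_∈ₛ? S) edges-touch-S-once ⟩
      length M                                   ∎)
    where
    open ≤-Reasoning
    edges-touch-S-once : All (λ e → proj₁ e ∉ₛ S ⊎ proj₂ e ∉ₛ S) M
    edges-touch-S-once = All.map (stable-edge S-stable) (proj₁ M-matching)
    S⊆matched : ¬ (∃ λ x → x ∈ₛ S × x ∉ₗ endpoints G M) →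
                ∀ {x} → x ∈ₛ S → x ∈ₗ filter (_∈ₛ? S) (endpoints G M)
    S⊆matched ∄x {x} x∈S =
      ∈-filter⁺ (_∈ₛ? S) (decidable-stable (x ∈ₗ? endpoints G M) λ x∉M → ∄x (x , x∈S , x∉M)) x∈S

  ∅-stable : IsStable G ∅
  ∅-stable u _ u∈∅ _ = contradiction u∈∅ ∉⊥

  private
    stable-of-size? : Decidable (λ k → ∃ λ S → IsStable G S × ∣ S ∣ ≡ k)
    stable-of-size? k = anySubset? λ S → stable? S ×-dec (∣ S ∣ ≟ k)

    matching-of-size? : Decidable (λ k → ∃ λ M → IsMatching G M × length M ≡ k)
    matching-of-size? k = lists-of-length? Fin²-searchable k matching?

  α-exists : ∃ (IsAlpha G)
  α-exists with _ , (S , S-stable , refl) , S-greatest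
                 ← ∃-greatest stable-of-size? (∅ , ∅-stable , ∣⊥∣≡0 n) n (λ { _ (S , _ , refl) → ∣p∣≤n S }) =
    ∣ S ∣ , (S , S-stable , refl) , λ T T-stable → S-greatest ∣ T ∣ (T , T-stable , refl)

  μ-exists : ∃ (IsMu G)
  μ-exists with _ , (M , M-matching , refl) , M-greatest
                 ← ∃-greatest matching-of-size? ([] , ([] , []) , refl) n
                              (λ { _ (M , M-matching , refl) → matching-length≤n M-matching }) =
    length M , (M , M-matching , refl) , λ N N-matching → M-greatest (length N) (N , N-matching , refl)

  stable∧size≡α⇔IsMaxStable : ∀ {a T} → IsAlpha G a → (IsStable G T × ∣ T ∣ ≡ a) ⇔ IsMaxStable G T
  stable∧size≡α⇔IsMaxStable ((S , S-stable , S≡a) , a-max) = mk⇔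
    (λ (T-stable , T≡a) → T-stable , λ U U-stable → ≤-trans (a-max U U-stable) (≤-reflexive (sym T≡a)))
    (λ (T-stable , T-max) → T-stable , ≤-antisym (a-max _ T-stable) (subst (_≤ _) S≡a (T-max S S-stable)))

  IsMaxStable⇒IsAlpha : ∀ {T} → IsMaxStable G T → IsAlpha G ∣ T ∣
  IsMaxStable⇒IsAlpha {T} (T-stable , T-max) = (T , T-stable , refl) , T-max

  μ-size : ∀ {m} → IsMu G m → 2 * m ≤ n
  μ-size ((_ , M-matching , refl) , _) = matching-size M-matching

  maxStable-exists : ∃ (IsMaxStable G)
  maxStable-exists with _ , α@((S , S-stable , S≡a) , _) ← α-exists =
    S , Equivalence.to (stable∧size≡α⇔IsMaxStable α) (S-stable , S≡a)

  maxStable? : Decidable (IsMaxStable G)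
  maxStable? T with a , α ← α-exists = Dec.map (stable∧size≡α⇔IsMaxStable α) (stable? T ×-dec (∣ T ∣ ≟ a))

  core-exists : ∃ (IsCore G)
  core-exists = fromDec in-core? , λ v → C⊆maxStable , maxStable-common⊆C
    where
    in-core? : Decidable (λ v → ¬ (∃ λ T → IsMaxStable G T × v ∉ₛ T))
    in-core? v = ¬? (anySubset? λ T → maxStable? T ×-dec ¬? (v ∈ₛ? T))
    C⊆maxStable : ∀ {v} → v ∈ₛ fromDec in-core? → ∀ T → IsMaxStable G T → v ∈ₛ T
    C⊆maxStable {v} v∈C T T-max =
      decidable-stable (v ∈ₛ? T) λ v∉T → Equivalence.to (∈-fromDec in-core?) v∈C (T , T-max , v∉T)
    maxStable-common⊆C : ∀ {v} → (∀ T → IsMaxStable G T → v ∈ₛ T) → v ∈ₛ fromDec in-core?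
    maxStable-common⊆C v∈all = Equivalence.from (∈-fromDec in-core?) λ (T , T-max , v∉T) → v∉T (v∈all T T-max)

  nbhd-exists : ∀ A → ∃ (IsNbhd G A)
  nbhd-exists A = fromDec adjacent? , λ v → Equivalence.to (∈-fromDec adjacent?) , Equivalence.from (∈-fromDec adjacent?)
    where
    adjacent? : Decidable (λ v → ∃ λ u → u ∈ₛ A × adj G u v ≡ true)
    adjacent? v = Fin.any? λ u → u ∈ₛ? A ×-dec (adj G u v Bool.≟ true)

  covering⇒2∣M∣≡n : ∀ {M} → IsMatching G M → (∀ v → v ∈ₗ endpoints G M) → 2 * length M ≡ n
  covering⇒2∣M∣≡n {M} M-matching covering =
    ≤-antisym (matching-size M-matching) (subst (n ≤_) (length-endpoints M) (complete⇒n≤length covering))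

  2∣M∣≡n⇒covering : ∀ {M} → IsMatching G M → 2 * length M ≡ n → ∀ v → v ∈ₗ endpoints G M
  2∣M∣≡n⇒covering {M} (_ , M!) 2M≡n = Unique∧length≡n⇒complete M! (trans (length-endpoints M) 2M≡n)

  perfect⇒quasiRegularizable : HasPerfectMatching G → IsQuasiRegularizable G
  perfect⇒quasiRegularizable (M , M-matching , covering) = w , w-sym , w-non-edge , 1 , ≤-refl , w-regular
    where
    w : Fin n → Fin n → ℕ
    w u = χ ⁅ mate M u ⁆

    mate-swap : ∀ {u v} → v ∈ₛ ⁅ mate M u ⁆ → u ∈ₛ ⁅ mate M v ⁆
    mate-swap {u} {v} v∈ = Equivalence.from x∈⁅y⁆⇔x≡y (begin
      u                   ≡⟨ mate-involutive M-matching u ⟨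
      mate M (mate M u)   ≡⟨ cong (mate M) (x∈⁅y⁆⇒x≡y _ v∈) ⟨
      mate M v            ∎)
      where open ≡-Reasoning

    w-sym : ∀ u v → w u v ≡ w v u
    w-sym u v with v ∈ₛ? ⁅ mate M u ⁆ | u ∈ₛ? ⁅ mate M v ⁆
    ... | yes _  | yes _  = refl
    ... | no _   | no _   = refl
    ... | yes v∈ | no u∉  = contradiction (mate-swap v∈) u∉
    ... | no v∉  | yes u∈ = contradiction (mate-swap u∈) v∉

    w-non-edge : ∀ u v → adj G u v ≡ false → w u v ≡ 0
    w-non-edge u v ¬uv with v ∈ₛ? ⁅ mate M u ⁆
    ... | no _   = refl
    ... | yes v∈ = contradiction (trans (sym ¬uv) uv) λ ()
      where
      uv : adj G u v ≡ true
      uv = subst (λ x → adj G u x ≡ true) (sym (x∈⁅y⁆⇒x≡y _ v∈)) (mate-adj M-matching (covering u))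

    w-regular : ∀ u → sumFin (w u) ≡ 1
    w-regular u = trans (sumFin≡sum (w u)) (trans (∑χ≡∣p∣ ⁅ mate M u ⁆) (∣⁅x⁆∣≡1 (mate M u)))

  quasiRegularizable⇒∣S∣≤∣∁S∣ : IsQuasiRegularizable G → ∀ {S} → IsStable G S → ∣ S ∣ ≤ ∣ ∁ S ∣
  quasiRegularizable⇒∣S∣≤∣∁S∣ (w , w-sym , w-non-edge , d , d≥1 , w-regular) {S} S-stable =
    *-cancelʳ-≤ ∣ S ∣ ∣ ∁ S ∣ d {{>-nonZero d≥1}}
      (regular⇒∣S∣*d≤∣∁S∣*d w w-sym (λ v → trans (sym (sumFin≡sum (w v))) (w-regular v)) S
                            (λ u∈S v∈S → w-non-edge _ _ (S-stable _ _ u∈S v∈S)))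

  perfect⇒∣A∣≤∣N[A]∣ : HasPerfectMatching G → ∀ {A B} → IsNbhd G A B → ∣ A ∣ ≤ ∣ B ∣
  perfect⇒∣A∣≤∣N[A]∣ (M , M-matching , covering) B-nbhd =
    injective⇒∣p∣≤∣q∣ (mate-injective M-matching) λ {a} a∈A →
      proj₂ (B-nbhd (mate M a)) (a , a∈A , mate-adj M-matching (covering a))

  module _ (ke : IsKE G) {M} (M-matching : IsMatching G M)
           (M-maximum : ∀ N → IsMatching G N → length N ≤ length M)
           {C B} (C-core : IsCore G C) (B-nbhd : IsNbhd G C B) where

    private
      maxStable-tight : ∀ {T} → IsMaxStable G T → ∣ T ∣ + length M ≡ n
      maxStable-tight T-max = ke _ _ (IsMaxStable⇒IsAlpha T-max) ((M , M-matching , refl) , M-maximum)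

      module TightMax {T} (T-max : IsMaxStable G T) = Tight (proj₁ T-max) M-matching (maxStable-tight T-max)

      unmatched∈C : ∀ {x} → x ∉ₗ endpoints G M → x ∈ₛ C
      unmatched∈C {x} x∉M =
        proj₂ (C-core x) λ T T-max → decidable-stable (x ∈ₛ? T) (x∉M ∘ TightMax.outside-matched T-max)

      B∉maxStable : ∀ {b T} → b ∈ₛ B → IsMaxStable G T → b ∉ₛ T
      B∉maxStable {b} b∈B (T-stable , T-max) b∈T with u , u∈C , ub ← proj₁ (B-nbhd b) b∈B =
        contradiction (trans (sym ub) (T-stable u b (proj₁ (C-core u) u∈C _ (T-stable , T-max)) b∈T)) λ ()

      B-matched : ∀ {b} → b ∈ₛ B → b ∈ₗ endpoints G M
      B-matched b∈B with S , S-max ← maxStable-exists = TightMax.outside-matched S-max (B∉maxStable b∈B S-max)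

      mate[B]⊆C : ∀ {b} → b ∈ₛ B → mate M b ∈ₛ C
      mate[B]⊆C b∈B = proj₂ (C-core _) λ T T-max →
        TightMax.mate-outside∈T T-max (B-matched b∈B) (B∉maxStable b∈B T-max)

    unmatched⇒∣B∣<∣C∣ : ∀ {x} → x ∉ₗ endpoints G M → ∣ B ∣ < ∣ C ∣
    unmatched⇒∣B∣<∣C∣ x∉M =
      injective-missing⇒∣p∣<∣q∣ (mate-injective M-matching) mate[B]⊆C (unmatched∈C x∉M) λ b∈B mate≡x → x∉M (subst (_∈ₗ endpoints G M) mate≡x (mate-∈ M-matching (B-matched b∈B)))

-- König–Egerváry graphs

2*m≡m+m : ∀ m → 2 * m ≡ m + m
2*m≡m+m m = cong (m +_) (+-identityʳ m)

module _ {n : ℕ} (G : Graph n) (ke : IsKE G) where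

  α≤μ⇒2α≡n : (∀ {a m} → IsAlpha G a → IsMu G m → a + m ≡ n → a ≤ m) → ∀ a → IsAlpha G a → 2 * a ≡ n
  α≤μ⇒2α≡n α≤μ a α with m , μ ← μ-exists G = begin
      2 * a   ≡⟨ 2*m≡m+m a ⟩
      a + a   ≡⟨ cong (a +_) (≤-antisym (α≤μ α μ a+m≡n) m≤a) ⟩
      a + m   ≡⟨ a+m≡n ⟩
      n       ∎
    where
    open ≡-Reasoning
    a+m≡n : a + m ≡ n
    a+m≡n = ke a m α μ
    m≤a : m ≤ a
    m≤a = +-cancelʳ-≤ m m a (subst₂ _≤_ (2*m≡m+m m) (sym a+m≡n) (μ-size G μ))

  2α≡n⇒perfect : (∀ a → IsAlpha G a → 2 * a ≡ n) → HasPerfectMatching G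
  2α≡n⇒perfect 2α≡n with a , α ← α-exists G | _ , μ@((M , M-matching , refl) , _) ← μ-exists G =
    M , M-matching , 2∣M∣≡n⇒covering G M-matching (trans (cong (2 *_) M≡a) (2α≡n a α))
    where
    M≡a : length M ≡ a
    M≡a = +-cancelˡ-≡ a (length M) a (trans (ke a _ α μ) (trans (sym (2α≡n a α)) (2*m≡m+m a)))

  perfect⇒2α≡n : HasPerfectMatching G → ∀ a → IsAlpha G a → 2 * a ≡ n
  perfect⇒2α≡n (M₀ , M₀-matching , covering) = α≤μ⇒2α≡n α≤μ
    where
    α≤μ : ∀ {a m} → IsAlpha G a → IsMu G m → a + m ≡ n → a ≤ m
    α≤μ {a} {m} _ (_ , m-max) a+m≡n = +-cancelʳ-≤ m a m (begin
      a + m           ≡⟨ a+m≡n ⟩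
      n               ≡⟨ covering⇒2∣M∣≡n G M₀-matching covering ⟨
      2 * length M₀   ≤⟨ *-monoʳ-≤ 2 (m-max M₀ M₀-matching) ⟩
      2 * m           ≡⟨ 2*m≡m+m m ⟩
      m + m           ∎)
      where open ≤-Reasoning

  quasiRegularizable⇒2α≡n : IsQuasiRegularizable G → ∀ a → IsAlpha G a → 2 * a ≡ n
  quasiRegularizable⇒2α≡n qr = α≤μ⇒2α≡n α≤μ
    where
    α≤μ : ∀ {a m} → IsAlpha G a → IsMu G m → a + m ≡ n → a ≤ m
    α≤μ ((S , S-stable , refl) , _) _ S+m≡n =
      subst (∣ S ∣ ≤_) (∣p∣+m≡n⇒∣∁p∣≡m {p = S} S+m≡n)
            (quasiRegularizable⇒∣S∣≤∣∁S∣ G qr S-stable)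

  coreExpands⇒2α≡n : (∀ C B → IsCore G C → IsNbhd G C B → ∣ C ∣ ≤ ∣ B ∣) →
                     ∀ a → IsAlpha G a → 2 * a ≡ n
  coreExpands⇒2α≡n core-expands = α≤μ⇒2α≡n α≤μ
    where
    α≤μ : ∀ {a m} → IsAlpha G a → IsMu G m → a + m ≡ n → a ≤ m
    α≤μ ((S , S-stable , refl) , _) ((M , M-matching , refl) , M-maximum) _ =
      decidable-stable (∣ S ∣ ≤? length M) λ S≰M →
        let x , _ , x∉M = stable-unmatched G S-stable M-matching (≰⇒> S≰M)
            C , C-core  = core-exists G
            B , B-nbhd  = nbhd-exists G C
        in <⇒≱ (unmatched⇒∣B∣<∣C∣ G ke M-matching M-maximum C-core B-nbhd x∉M)
               (core-expands C B C-core B-nbhd)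

theorem7 : ∀ {n} (G : Graph n) → IsKE G →
    ((∀ a → IsAlpha G a → 2 * a ≡ n) ⇔ HasPerfectMatching G)
    × (HasPerfectMatching G ⇔ IsQuasiRegularizable G)
    × (IsQuasiRegularizable G ⇔ (∀ C B → IsCore G C → IsNbhd G C B → ∣ C ∣ ≤ ∣ B ∣))
theorem7 G ke =
    mk⇔ (2α≡n⇒perfect G ke) (perfect⇒2α≡n G ke)
  , mk⇔ (perfect⇒quasiRegularizable G) (2α≡n⇒perfect G ke ∘ quasiRegularizable⇒2α≡n G ke)
  , mk⇔ (λ qr _ _ _ → perfect⇒∣A∣≤∣N[A]∣ G (2α≡n⇒perfect G ke (quasiRegularizable⇒2α≡n G ke qr)))
        (perfect⇒quasiRegularizable G ∘ 2α≡n⇒perfect G ke ∘ coreExpands⇒2α≡n G ke)
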